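{- Let $\phi$ be a Boolean formula in variables $y_1,\dots,y_m$ with distinct models $\sigma_1,\dots,\sigma_N$, and let $d_{ij}$ be the Hamming distance between $\sigma_i$ and $\sigma_j$. Let $s\ge1$, $\lambda\in(0,\tfrac12]$, $\rho=1-2\lambda$, let $c_1,\dots,c_s$ be XOR constraints drawn independently from the distribution below, $\chi_s=\phi\wedge c_1\wedge\cdots\wedge c_s$, $T_s=\#\chi_s$ the number of models of $\chi_s$, and $\mu_s=E[T_s]$. Then: (1) $\mu_s=N2^{ -s}$; (2) $\mathrm{var}(T_s)=\mu_s+4^{ -s}\sum_{i=1}^N\sum_{j\ne i}(1+\rho^{d_{ij}})^s-\mu_s^2$; (3) if $N\ne0$, then $\dfrac{\mathrm{var}(T_s)}{\mu_s^2}=\mu_s^{ -1}+N^{ -2}\sum_{i=1}^N\sum_{j\ne i}(1+\rho^{d_{ij}})^s-1$.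
   Context: An XOR constraint on $y_1,\dots,y_m$ is an equation $a_0=a_1y_1\oplus\cdots\oplus a_my_m$ with $(a_0,\dots,a_m)\in\mathbb{F}_2^{m+1}$; constraints are drawn with $a_0$ uniform in $\{0,1\}$ and each $a_i$ ($i\ge1$) equal to $1$ independently with probability $\lambda$ and $0$ with probability $1-\lambda$.
   Formalization: The parameter λ takes only rational values in $(0,\tfrac12]$. -}

module Defs where

open import Data.Bool using (Bool; true; false; _∧_; _xor_; if_then_else_)
open import Data.Nat as ℕ using (ℕ; zero; suc)
open import Data.Integer using (+_)
open import Data.Rational using (ℚ; 0ℚ; 1ℚ; _+_; _*_; _-_; _/_)
open import Data.Rational.Properties using (_≟_)
open import Data.Vec using (Vec; []; _∷_; zipWith; foldr)
open import Data.List as List using (List; []; _∷_; _++_; filter; length; concatMap)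
open import Relation.Nullary using (yes; no)
open import Relation.Nullary.Decidable using (does)
open import Relation.Binary.PropositionalEquality using (_≡_)

ℕtoℚ : ℕ → ℚ
ℕtoℚ n = + n / 1

_^_ : ℚ → ℕ → ℚ
q ^ zero  = 1ℚ
q ^ suc n = q * (q ^ n)

sumℚ : List ℚ → ℚ
sumℚ = List.foldr _+_ 0ℚ

-- total inverse (with the convention 1/0 = 0) and total division
inv : ℚ → ℚ
inv q with q ≟ 0ℚ
... | yes _ = 0ℚ
... | no ¬p = Data.Rational.1/_ q {{Data.Rational.≢-nonZero ¬p}}
  where import Data.Rational

_÷'_ : ℚ → ℚ → ℚ
p ÷' q = p * inv q

allVecs : (m : ℕ) → List (Vec Bool m)
allVecs zero    = [] ∷ []
allVecs (suc m) = List.map (true ∷_) (allVecs m) ++ List.map (false ∷_) (allVecs m)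

Formula : ℕ → Set
Formula m = Vec Bool m → Bool

models : {m : ℕ} → Formula m → List (Vec Bool m)
models {m} φ = filter (λ y → φ y Data.Bool.≟ true) (allVecs m)
  where import Data.Bool

hamming : {m : ℕ} → Vec Bool m → Vec Bool m → ℕ
hamming []       []       = 0
hamming (x ∷ xs) (y ∷ ys) = (if x xor y then 1 else 0) ℕ.+ hamming xs ys

-- XOR constraint  a₀ = a₁y₁ ⊕ ⋯ ⊕ aₘyₘ,  stored as (a₀, (a₁,…,aₘ))
record XorConstraint (m : ℕ) : Set where
  constructor xc
  field
    a₀ : Bool
    as : Vec Bool m

allConstraints : (m : ℕ) → List (XorConstraint m)
allConstraints m = concatMap (λ b → List.map (xc b) (allVecs m)) (true ∷ false ∷ [])

satXor : {m : ℕ} → XorConstraint m → Vec Bool m → Bool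
satXor (xc a₀ as) y = not (a₀ xor foldr _ _xor_ false (zipWith _∧_ as y))
  where open Data.Bool using (not)

-- probability of a single constraint: a₀ uniform, each aᵢ = 1 w.p. λ
probXor : {m : ℕ} → ℚ → XorConstraint m → ℚ
probXor λ' (xc _ as) = (+ 1 / 2) * foldr _ (λ a r → (if a then λ' else 1ℚ - λ') * r) 1ℚ as

allConstraintTuples : (m s : ℕ) → List (Vec (XorConstraint m) s)
allConstraintTuples m zero    = [] ∷ []
allConstraintTuples m (suc s) =
  concatMap (λ c → List.map (c ∷_) (allConstraintTuples m s)) (allConstraints m)

probTuple : {m s : ℕ} → ℚ → Vec (XorConstraint m) s → ℚ
probTuple λ' cs = foldr _ (λ c r → probXor λ' c * r) 1ℚ cs

countModels : {m s : ℕ} → Formula m → Vec (XorConstraint m) s → ℕ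
countModels {m} φ cs =
  length (filter (λ y → (φ y ∧ foldr _ (λ c r → satXor c y ∧ r) true cs) Data.Bool.≟ true) (allVecs m))
  where import Data.Bool

expect : {m s : ℕ} → ℚ → (Vec (XorConstraint m) s → ℚ) → ℚ
expect {m} {s} λ' X = sumℚ (List.map (λ cs → probTuple λ' cs * X cs) (allConstraintTuples m s))

variance : {m s : ℕ} → ℚ → (Vec (XorConstraint m) s → ℚ) → ℚ
variance λ' X = expect λ' (λ cs → X cs * X cs) - (expect λ' X * expect λ' X)

T : {m s : ℕ} → Formula m → Vec (XorConstraint m) s → ℚ
T φ cs = ℕtoℚ (countModels φ cs)

-- Σ_{i} Σ_{j ≠ i} f(σᵢ, σⱼ) over the models list (indices i ≠ j)
sumOffDiag : {A : Set} → (A → A → ℚ) → List A → ℚ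
sumOffDiag f xs = go [] xs
  where
  go : List _ → List _ → ℚ
  go pre []       = 0ℚ
  go pre (x ∷ post) = sumℚ (List.map (f x) (pre ++ post)) + go (pre ++ (x ∷ [])) post

-- Write T_s as the sum over the models σ of φ of the product of the indicators [cᵢ(σ)].
-- The constraints are independent, so E ∏ᵢ g(cᵢ) = (E g(c))^s and everything reduces to a
-- single constraint c = (a₀, a). For fixed a exactly one value of a₀ is satisfied by σ, so
-- P[c(σ)] = ½, while c(σ) ∧ c(τ) holds for some a₀ iff a·σ = a·τ, and then for exactly one;
-- hence P[c(σ) ∧ c(τ)] = (1 + E[(-1)^(a·σ ⊕ a·τ)]) / 4. This bias factorises over the
-- coordinates: where σ and τ differ a coordinate contributes λ·(-1) + (1 - λ) = ρ, elsewhere 1,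
-- so it equals ρ^d(σ,τ). Thus E[T_s] = N 2^-s and E[T_s²] = 4^-s Σ_{σ,τ} (1 + ρ^d(σ,τ))^s,
-- whose diagonal part is μ_s; (3) is then field arithmetic with μ_s = N 2^-s.

{-# OPTIONS --safe #-}
module Submission where

open import Defs
open import Data.Nat using (ℕ; _≥_)
open import Data.Bool using (Bool)
open import Data.Vec using (Vec)
open import Data.List using (length)
open import Data.Product using (_×_)
open import Data.Rational using (ℚ; 0ℚ; 1ℚ; ½; _+_; _*_; _-_; _<_; _≤_; _/_)
open import Data.Integer using (+_)
open import Relation.Binary.PropositionalEquality using (_≡_; _≢_)

open import Algebra.Bundles using (CommutativeMonoid)
import Algebra.Properties.CommutativeSemigroup as CommutativeSemigroupProperties
open import Data.Bool using (true; false; not; _∧_; _xor_; if_then_else_)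
import Data.Bool as Bool
open import Data.Empty using (⊥-elim)
import Data.Integer as ℤ
import Data.Integer.Properties as ℤ
open import Data.List using (List; []; _∷_; _++_; map; filter; concatMap)
open import Data.List.Properties using (++-assoc)
import Data.Nat as ℕ
open import Data.Nat using (zero; suc)
open import Data.Nat.Coprimality using (1-coprimeTo) renaming (sym to coprime-sym)
open import Data.Product using (_,_)
open import Data.Rational using (mkℚ; -_; ≢-nonZero)
open import Data.Rational.Properties
  using ( _≟_; +-identityˡ; +-identityʳ; +-assoc; *-identityˡ; *-identityʳ; *-assoc
        ; *-zeroˡ; *-zeroʳ; *-distribˡ-+; *-distribʳ-+; *-inverseʳ; normalize-coprime
        ; +-0-commutativeMonoid; *-1-commutativeMonoid )
open import Data.Rational.Solver using (module +-*-Solver)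
open import Data.Vec using ([]; _∷_; foldr; zipWith)
open import Function using (_∋_)
open import Relation.Binary.PropositionalEquality
  using (refl; sym; trans; cong; cong₂; module ≡-Reasoning)
open import Relation.Nullary using (yes; no)

open +-*-Solver using (solve; _:=_; _:+_; _:*_; _:-_; con)
open CommutativeSemigroupProperties (CommutativeMonoid.commutativeSemigroup +-0-commutativeMonoid)
  using () renaming (interchange to +-interchange; x∙yz≈y∙xz to +-leftComm)
open CommutativeSemigroupProperties (CommutativeMonoid.commutativeSemigroup *-1-commutativeMonoid)
  using () renaming (interchange to *-interchange)
open ≡-Reasoning

private
  variable
    A B : Set

∑-syntax : List A → (A → ℚ) → ℚ
∑-syntax xs f = sumℚ (map f xs)

infix 5 ∑-syntax
syntax ∑-syntax xs (λ x → e) = ∑[ x ← xs ] e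

∑-cong : {f g : A → ℚ} → (∀ x → f x ≡ g x) → ∀ xs → ∑[ x ← xs ] f x ≡ ∑[ x ← xs ] g x
∑-cong f≡g []       = refl
∑-cong f≡g (x ∷ xs) = cong₂ _+_ (f≡g x) (∑-cong f≡g xs)

∑-++ : (f : A → ℚ) (xs ys : List A) → ∑[ x ← xs ++ ys ] f x ≡ (∑[ x ← xs ] f x) + (∑[ y ← ys ] f y)
∑-++ f []       ys = sym (+-identityˡ _)
∑-++ f (x ∷ xs) ys = trans (cong (λ r → f x + r) (∑-++ f xs ys)) (sym (+-assoc (f x) _ _))

∑-++-∷ : (f : A → ℚ) (xs : List A) (y : A) (ys : List A) →
         ∑[ x ← xs ++ y ∷ ys ] f x ≡ f y + (∑[ x ← xs ++ ys ] f x)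
∑-++-∷ f []       y ys = refl
∑-++-∷ f (x ∷ xs) y ys = trans (cong (λ r → f x + r) (∑-++-∷ f xs y ys)) (+-leftComm (f x) (f y) _)

∑-map : (f : B → ℚ) (g : A → B) (xs : List A) → ∑[ y ← map g xs ] f y ≡ ∑[ x ← xs ] f (g x)
∑-map f g []       = refl
∑-map f g (x ∷ xs) = cong (λ r → f (g x) + r) (∑-map f g xs)

∑-concatMap : (f : B → ℚ) (g : A → List B) (xs : List A) →
              ∑[ y ← concatMap g xs ] f y ≡ ∑[ x ← xs ] ∑[ y ← g x ] f y
∑-concatMap f g []       = refl
∑-concatMap f g (x ∷ xs) =
  trans (∑-++ f (g x) (concatMap g xs)) (cong (λ r → (∑[ y ← g x ] f y) + r) (∑-concatMap f g xs))

*-distribˡ-∑ : (k : ℚ) (f : A → ℚ) (xs : List A) → k * (∑[ x ← xs ] f x) ≡ ∑[ x ← xs ] k * f x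
*-distribˡ-∑ k f []       = *-zeroʳ k
*-distribˡ-∑ k f (x ∷ xs) = trans (*-distribˡ-+ k (f x) _) (cong (λ r → k * f x + r) (*-distribˡ-∑ k f xs))

*-distribʳ-∑ : (k : ℚ) (f : A → ℚ) (xs : List A) → (∑[ x ← xs ] f x) * k ≡ ∑[ x ← xs ] f x * k
*-distribʳ-∑ k f []       = *-zeroˡ k
*-distribʳ-∑ k f (x ∷ xs) = trans (*-distribʳ-+ k (f x) _) (cong (λ r → f x * k + r) (*-distribʳ-∑ k f xs))

∑-distrib-+ : (f g : A → ℚ) (xs : List A) → ∑[ x ← xs ] (f x + g x) ≡ (∑[ x ← xs ] f x) + (∑[ x ← xs ] g x)
∑-distrib-+ f g []       = refl
∑-distrib-+ f g (x ∷ xs) =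
  trans (cong (λ r → (f x + g x) + r) (∑-distrib-+ f g xs)) (+-interchange (f x) (g x) _ _)

∑-zero : (xs : List A) → ∑[ x ← xs ] 0ℚ ≡ 0ℚ
∑-zero []       = refl
∑-zero (x ∷ xs) = trans (+-identityˡ _) (∑-zero xs)

∑-comm : (f : A → B → ℚ) (xs : List A) (ys : List B) →
         ∑[ x ← xs ] ∑[ y ← ys ] f x y ≡ ∑[ y ← ys ] ∑[ x ← xs ] f x y
∑-comm f []       ys = sym (∑-zero ys)
∑-comm f (x ∷ xs) ys = trans (cong (λ r → (∑[ y ← ys ] f x y) + r) (∑-comm f xs ys))
                             (sym (∑-distrib-+ (f x) (λ y → ∑[ x ← xs ] f x y) ys))

∑-*-∑ : (f g : A → ℚ) (xs ys : List A) →
        (∑[ x ← xs ] f x) * (∑[ y ← ys ] g y) ≡ ∑[ x ← xs ] ∑[ y ← ys ] f x * g y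
∑-*-∑ f g xs ys = trans (*-distribʳ-∑ _ f xs) (∑-cong (λ x → *-distribˡ-∑ (f x) g ys) xs)

-- Once the numerator of ℕtoℚ n is exposed, the sum computes to (+ 1 ℤ.+ + n ℤ.* + 1) / 1.
ℕtoℚ-suc : ∀ n → ℕtoℚ (suc n) ≡ 1ℚ + ℕtoℚ n
ℕtoℚ-suc n = sym (begin
  1ℚ + ℕtoℚ n                   ≡⟨ cong (λ q → 1ℚ + q) (normalize-coprime n-coprime-1) ⟩
  1ℚ + mkℚ (+ n) 0 n-coprime-1  ≡⟨ cong (λ k → (+ 1 ℤ.+ k) / 1) (ℤ.*-identityʳ (+ n)) ⟩
  ℕtoℚ (suc n)                  ∎)
  where n-coprime-1 = coprime-sym (1-coprimeTo n)

ℕtoℚ-≢0 : ∀ {n} → n ≢ 0 → ℕtoℚ n ≢ 0ℚ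
ℕtoℚ-≢0 {zero}  n≢0 = ⊥-elim (n≢0 refl)
ℕtoℚ-≢0 {suc n} _ eq with trans (sym (normalize-coprime (coprime-sym (1-coprimeTo (suc n))))) eq
... | ()

∑-const : (k : ℚ) (xs : List A) → ∑[ x ← xs ] k ≡ ℕtoℚ (length xs) * k
∑-const k []       = sym (*-zeroˡ k)
∑-const k (x ∷ xs) = begin
  k + (∑[ x ← xs ] k)          ≡⟨ cong (λ r → k + r) (∑-const k xs) ⟩
  k + n * k                    ≡⟨ solve 2 (λ k n → k :+ n :* k := (con 1ℚ :+ n) :* k) refl k n ⟩
  (1ℚ + n) * k                 ≡⟨ cong (_* k) (sym (ℕtoℚ-suc (length xs))) ⟩
  ℕtoℚ (length (x ∷ xs)) * k   ∎
  where n = ℕtoℚ (length xs)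

-- sumOffDiag is computed by a local helper that is out of scope here; abstracting [] turns
-- the defining equation into a pattern, so unification solves the meta with that helper.
mutual
  sumOffDiagFrom : (A → A → ℚ) → List A → List A → ℚ
  sumOffDiagFrom = _

  sumOffDiag≡sumOffDiagFrom : (f : A → A → ℚ) (xs : List A) → sumOffDiag f xs ≡ sumOffDiagFrom f [] xs
  sumOffDiag≡sumOffDiagFrom {A} f xs with List A ∋ []
  ... | _ = refl

∑∑≡∑diag+sumOffDiagFrom : (f : A → A → ℚ) (xs ys : List A) →
  ∑[ y ← ys ] ∑[ z ← xs ++ ys ] f y z ≡ (∑[ y ← ys ] f y y) + sumOffDiagFrom f xs ys
∑∑≡∑diag+sumOffDiagFrom f xs []       = refl
∑∑≡∑diag+sumOffDiagFrom f xs (y ∷ ys) = begin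
  (∑[ z ← xs ++ y ∷ ys ] f y z) + (∑[ y′ ← ys ] ∑[ z ← xs ++ y ∷ ys ] f y′ z)
    ≡⟨ cong₂ _+_ (∑-++-∷ (f y) xs y ys) (∑-cong (λ y′ → cong (λ zs → ∑[ z ← zs ] f y′ z) reassoc) ys) ⟩
  (f y y + (∑[ z ← xs ++ ys ] f y z)) + (∑[ y′ ← ys ] ∑[ z ← (xs ++ y ∷ []) ++ ys ] f y′ z)
    ≡⟨ cong (λ r → (f y y + (∑[ z ← xs ++ ys ] f y z)) + r) (∑∑≡∑diag+sumOffDiagFrom f (xs ++ y ∷ []) ys) ⟩
  (f y y + (∑[ z ← xs ++ ys ] f y z)) + ((∑[ y′ ← ys ] f y′ y′) + sumOffDiagFrom f (xs ++ y ∷ []) ys)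
    ≡⟨ +-interchange (f y y) _ _ _ ⟩
  (f y y + (∑[ y′ ← ys ] f y′ y′)) + ((∑[ z ← xs ++ ys ] f y z) + sumOffDiagFrom f (xs ++ y ∷ []) ys)
    ∎
  where reassoc = sym (++-assoc xs (y ∷ []) ys)

∑∑≡∑diag+sumOffDiag : (f : A → A → ℚ) (xs : List A) →
  ∑[ x ← xs ] ∑[ y ← xs ] f x y ≡ (∑[ x ← xs ] f x x) + sumOffDiag f xs
∑∑≡∑diag+sumOffDiag f xs = trans (∑∑≡∑diag+sumOffDiagFrom f [] xs)
  (cong (λ r → (∑[ x ← xs ] f x x) + r) (sym (sumOffDiag≡sumOffDiagFrom f xs)))

^-distribʳ-* : ∀ p q n → (p * q) ^ n ≡ p ^ n * q ^ n
^-distribʳ-* p q zero    = refl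
^-distribʳ-* p q (suc n) = trans (cong ((p * q) *_) (^-distribʳ-* p q n)) (*-interchange p q _ _)

^-zeroˡ : ∀ n → 1ℚ ^ n ≡ 1ℚ
^-zeroˡ zero    = refl
^-zeroˡ (suc n) = cong (1ℚ *_) (^-zeroˡ n)

*-inv : ∀ p → p ≢ 0ℚ → p * inv p ≡ 1ℚ
*-inv p p≢0 with p ≟ 0ℚ
... | yes p≡0 = ⊥-elim (p≢0 p≡0)
... | no  p≢0 = *-inverseʳ p {{≢-nonZero p≢0}}

inv-unique : ∀ p q → p * q ≡ 1ℚ → inv p ≡ q
inv-unique p q pq≡1 = begin
  inv p              ≡⟨ sym (*-identityʳ (inv p)) ⟩
  inv p * 1ℚ         ≡⟨ cong (inv p *_) (sym pq≡1) ⟩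
  inv p * (p * q)    ≡⟨ solve 3 (λ i p q → i :* (p :* q) := (p :* i) :* q) refl (inv p) p q ⟩
  (p * inv p) * q    ≡⟨ cong (_* q) (*-inv p p≢0) ⟩
  1ℚ * q             ≡⟨ *-identityˡ q ⟩
  q                  ∎
  where
  p≢0 : p ≢ 0ℚ
  p≢0 refl with trans (sym pq≡1) (*-zeroˡ q)
  ... | ()

relativeVariance : ∀ n h S {a b} → n * a ≡ 1ℚ → h * b ≡ 1ℚ →
  ((n * h + (h * h) * S) - (n * h) * (n * h)) ÷' ((n * h) * (n * h))
    ≡ (inv (n * h) + inv (n * n) * S) - 1ℚ
relativeVariance n h S {a} {b} na≡1 hb≡1 = begin
  ((μ + (h * h) * S) - μ * μ) * inv (μ * μ)
    ≡⟨ cong (((μ + (h * h) * S) - μ * μ) *_) (inv-unique (μ * μ) (ν * ν) μμνν≡1) ⟩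
  ((μ + (h * h) * S) - μ * μ) * (ν * ν)
    ≡⟨ expand n h S a b ⟩
  ((n * a) * (h * b)) * ν + ((h * b) * (h * b)) * ((a * a) * S) - ((n * a) * (h * b)) * ((n * a) * (h * b))
    ≡⟨ cong₂ (λ u v → (u * v) * ν + (v * v) * ((a * a) * S) - (u * v) * (u * v)) na≡1 hb≡1 ⟩
  1ℚ * ν + 1ℚ * ((a * a) * S) - 1ℚ
    ≡⟨ cong₂ (λ u v → u + v - 1ℚ) (*-identityˡ ν) (*-identityˡ ((a * a) * S)) ⟩
  (ν + (a * a) * S) - 1ℚ
    ≡⟨ cong₂ (λ u v → (u + v * S) - 1ℚ) (sym (inv-unique μ ν μν≡1))
                                         (sym (inv-unique (n * n) (a * a) nnaa≡1)) ⟩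
  (inv μ + inv (n * n) * S) - 1ℚ
    ∎
  where
  μ = n * h
  ν = a * b

  -- n and h are isolated in the products n * a and h * b, which are 1.
  expand : ∀ n h S a b → ((n * h + (h * h) * S) - (n * h) * (n * h)) * ((a * b) * (a * b))
                       ≡ ((n * a) * (h * b)) * (a * b) + ((h * b) * (h * b)) * ((a * a) * S)
                         - ((n * a) * (h * b)) * ((n * a) * (h * b))
  expand = solve 5 (λ n h S a b →
    ((n :* h :+ (h :* h) :* S) :- (n :* h) :* (n :* h)) :* ((a :* b) :* (a :* b))
      := ((n :* a) :* (h :* b)) :* (a :* b) :+ ((h :* b) :* (h :* b)) :* ((a :* a) :* S)
         :- ((n :* a) :* (h :* b)) :* ((n :* a) :* (h :* b))) refl

  μν≡1 : μ * ν ≡ 1ℚ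
  μν≡1 = trans (*-interchange n h a b) (cong₂ _*_ na≡1 hb≡1)
  nnaa≡1 : (n * n) * (a * a) ≡ 1ℚ
  nnaa≡1 = trans (*-interchange n n a a) (cong₂ _*_ na≡1 na≡1)
  μμνν≡1 : (μ * μ) * (ν * ν) ≡ 1ℚ
  μμνν≡1 = trans (*-interchange μ μ ν ν) (cong₂ _*_ μν≡1 μν≡1)

𝟙 : Bool → ℚ
𝟙 true  = 1ℚ
𝟙 false = 0ℚ

𝟙-∧ : ∀ a b → 𝟙 (a ∧ b) ≡ 𝟙 a * 𝟙 b
𝟙-∧ true  b = sym (*-identityˡ (𝟙 b))
𝟙-∧ false b = sym (*-zeroˡ (𝟙 b))

sign : Bool → ℚ
sign true  = - 1ℚ
sign false = 1ℚ

sign-xor : ∀ a b → sign (a xor b) ≡ sign a * sign b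
sign-xor true  true  = refl
sign-xor true  false = refl
sign-xor false true  = refl
sign-xor false false = refl

∏ : {n : ℕ} → (A → ℚ) → Vec A n → ℚ
∏ f xs = foldr _ (λ x r → f x * r) 1ℚ xs

∏-cong : {n : ℕ} {f g : A → ℚ} → (∀ x → f x ≡ g x) → (xs : Vec A n) → ∏ f xs ≡ ∏ g xs
∏-cong f≡g []       = refl
∏-cong f≡g (x ∷ xs) = cong₂ _*_ (f≡g x) (∏-cong f≡g xs)

∏-* : {n : ℕ} (f g : A → ℚ) (xs : Vec A n) → ∏ f xs * ∏ g xs ≡ ∏ (λ x → f x * g x) xs
∏-* f g []       = refl
∏-* f g (x ∷ xs) = trans (*-interchange (f x) _ (g x) _) (cong ((f x * g x) *_) (∏-* f g xs))

∑-allVecs-suc : {m : ℕ} (f : Vec Bool (suc m) → ℚ) →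
  ∑[ v ← allVecs (suc m) ] f v ≡ (∑[ v ← allVecs m ] f (true ∷ v)) + (∑[ v ← allVecs m ] f (false ∷ v))
∑-allVecs-suc {m} f = trans (∑-++ f (map (true ∷_) (allVecs m)) (map (false ∷_) (allVecs m)))
                            (cong₂ _+_ (∑-map f (true ∷_) (allVecs m)) (∑-map f (false ∷_) (allVecs m)))

weight : {m : ℕ} → ℚ → Vec Bool m → ℚ
weight λ' = ∏ (λ a → if a then λ' else 1ℚ - λ')

∑-weight : (m : ℕ) (λ' : ℚ) → ∑[ as ← allVecs m ] weight λ' as ≡ 1ℚ
∑-weight zero    λ' = refl
∑-weight (suc m) λ' = begin
  ∑[ as ← allVecs (suc m) ] weight λ' as
    ≡⟨ ∑-allVecs-suc {m} (weight λ') ⟩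
  (∑[ as ← allVecs m ] λ' * weight λ' as) + (∑[ as ← allVecs m ] (1ℚ - λ') * weight λ' as)
    ≡⟨ cong₂ _+_ (sym (*-distribˡ-∑ λ' (weight λ') (allVecs m)))
                 (sym (*-distribˡ-∑ (1ℚ - λ') (weight λ') (allVecs m))) ⟩
  λ' * (∑[ as ← allVecs m ] weight λ' as) + (1ℚ - λ') * (∑[ as ← allVecs m ] weight λ' as)
    ≡⟨ cong (λ r → λ' * r + (1ℚ - λ') * r) (∑-weight m λ') ⟩
  λ' * 1ℚ + (1ℚ - λ') * 1ℚ
    ≡⟨ solve 1 (λ l → l :* con 1ℚ :+ (con 1ℚ :- l) :* con 1ℚ := con 1ℚ) refl λ' ⟩
  1ℚ
    ∎

parity : {m : ℕ} → Vec Bool m → Vec Bool m → Bool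
parity as y = foldr _ _xor_ false (zipWith _∧_ as y)

bias : ℚ → ℚ
bias λ' = 1ℚ - ℕtoℚ 2 * λ'

∑-weight-sign-parity : {m : ℕ} (λ' : ℚ) (y z : Vec Bool m) →
  ∑[ as ← allVecs m ] weight λ' as * (sign (parity as y) * sign (parity as z)) ≡ bias λ' ^ hamming y z
∑-weight-sign-parity λ' [] [] = refl
∑-weight-sign-parity {suc m} λ' (y₀ ∷ y) (z₀ ∷ z) = begin
  ∑[ as ← allVecs (suc m) ] weight λ' as * (sign (parity as (y₀ ∷ y)) * sign (parity as (z₀ ∷ z)))
    ≡⟨ ∑-allVecs-suc {m} (λ as → weight λ' as * (sign (parity as (y₀ ∷ y)) * sign (parity as (z₀ ∷ z)))) ⟩
  (∑[ as ← V ] (λ' * weight λ' as) * (sign (y₀ xor parity as y) * sign (z₀ xor parity as z)))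
    + (∑[ as ← V ] ((1ℚ - λ') * weight λ' as) * χ as)
    ≡⟨ cong₂ _+_ (∑-cong factor-out-y₀z₀ V) (∑-cong (λ as → *-assoc (1ℚ - λ') (weight λ' as) (χ as)) V) ⟩
  (∑[ as ← V ] (λ' * sign (y₀ xor z₀)) * wχ as) + (∑[ as ← V ] (1ℚ - λ') * wχ as)
    ≡⟨ cong₂ _+_ (sym (*-distribˡ-∑ (λ' * sign (y₀ xor z₀)) wχ V)) (sym (*-distribˡ-∑ (1ℚ - λ') wχ V)) ⟩
  (λ' * sign (y₀ xor z₀)) * (∑[ as ← V ] wχ as) + (1ℚ - λ') * (∑[ as ← V ] wχ as)
    ≡⟨ cong (λ r → (λ' * sign (y₀ xor z₀)) * r + (1ℚ - λ') * r) (∑-weight-sign-parity λ' y z) ⟩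
  (λ' * sign (y₀ xor z₀)) * bias λ' ^ hamming y z + (1ℚ - λ') * bias λ' ^ hamming y z
    ≡⟨ coordinate-bias (y₀ xor z₀) ⟩
  bias λ' ^ hamming (y₀ ∷ y) (z₀ ∷ z)
    ∎
  where
  V = allVecs m

  χ : Vec Bool m → ℚ
  χ as = sign (parity as y) * sign (parity as z)

  wχ : Vec Bool m → ℚ
  wχ as = weight λ' as * χ as

  factor-out-y₀z₀ : ∀ as → (λ' * weight λ' as) * (sign (y₀ xor parity as y) * sign (z₀ xor parity as z))
                         ≡ (λ' * sign (y₀ xor z₀)) * wχ as
  factor-out-y₀z₀ as = begin
    (λ' * weight λ' as) * (sign (y₀ xor parity as y) * sign (z₀ xor parity as z))
      ≡⟨ cong₂ (λ u v → (λ' * weight λ' as) * (u * v)) (sign-xor y₀ (parity as y)) (sign-xor z₀ (parity as z)) ⟩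
    (λ' * weight λ' as) * ((sign y₀ * sign (parity as y)) * (sign z₀ * sign (parity as z)))
      ≡⟨ solve 6 (λ l w a p b q → (l :* w) :* ((a :* p) :* (b :* q)) := (l :* (a :* b)) :* (w :* (p :* q)))
               refl λ' (weight λ' as) (sign y₀) (sign (parity as y)) (sign z₀) (sign (parity as z)) ⟩
    (λ' * (sign y₀ * sign z₀)) * wχ as
      ≡⟨ cong (λ u → (λ' * u) * wχ as) (sym (sign-xor y₀ z₀)) ⟩
    (λ' * sign (y₀ xor z₀)) * wχ as
      ∎

  coordinate-bias : ∀ e → (λ' * sign e) * bias λ' ^ hamming y z + (1ℚ - λ') * bias λ' ^ hamming y z
                        ≡ bias λ' ^ ((if e then 1 else 0) ℕ.+ hamming y z)
  coordinate-bias true  = solve 2 (λ l r → (l :* con (- 1ℚ)) :* r :+ (con 1ℚ :- l) :* r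
                                           := (con 1ℚ :- con (ℕtoℚ 2) :* l) :* r)
                                  refl λ' (bias λ' ^ hamming y z)
  coordinate-bias false = solve 2 (λ l r → (l :* con 1ℚ) :* r :+ (con 1ℚ :- l) :* r := r)
                                  refl λ' (bias λ' ^ hamming y z)

expectXor : {m : ℕ} → ℚ → (XorConstraint m → ℚ) → ℚ
expectXor {m} λ' g = ∑[ c ← allConstraints m ] probXor λ' c * g c

expectXor-by-a₀ : {m : ℕ} (λ' : ℚ) (g : XorConstraint m → ℚ) →
  expectXor λ' g ≡ ∑[ as ← allVecs m ] (½ * weight λ' as) * (g (xc true as) + g (xc false as))
expectXor-by-a₀ {m} λ' g = begin
  expectXor λ' g
    ≡⟨ ∑-concatMap (λ c → probXor λ' c * g c) (λ a₀ → map (xc a₀) V) (true ∷ false ∷ []) ⟩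
  (∑[ c ← map (xc true) V ] probXor λ' c * g c) + ((∑[ c ← map (xc false) V ] probXor λ' c * g c) + 0ℚ)
    ≡⟨ cong₂ _+_ (∑-map (λ c → probXor λ' c * g c) (xc true) V)
                 (trans (+-identityʳ _) (∑-map (λ c → probXor λ' c * g c) (xc false) V)) ⟩
  (∑[ as ← V ] (½ * weight λ' as) * g (xc true as)) + (∑[ as ← V ] (½ * weight λ' as) * g (xc false as))
    ≡⟨ sym (∑-distrib-+ (λ as → (½ * weight λ' as) * g (xc true as))
                        (λ as → (½ * weight λ' as) * g (xc false as)) V) ⟩
  ∑[ as ← V ] ((½ * weight λ' as) * g (xc true as) + (½ * weight λ' as) * g (xc false as))
    ≡⟨ ∑-cong (λ as → sym (*-distribˡ-+ (½ * weight λ' as) (g (xc true as)) (g (xc false as)))) V ⟩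
  ∑[ as ← V ] (½ * weight λ' as) * (g (xc true as) + g (xc false as))
    ∎
  where V = allVecs m

satXor-a₀-count : ∀ p → 𝟙 (not (true xor p)) + 𝟙 (not (false xor p)) ≡ 1ℚ
satXor-a₀-count true  = refl
satXor-a₀-count false = refl

satXor-a₀-count₂ : ∀ p q →
  𝟙 (not (true xor p) ∧ not (true xor q)) + 𝟙 (not (false xor p) ∧ not (false xor q)) ≡ ½ * (1ℚ + sign p * sign q)
satXor-a₀-count₂ true  true  = refl
satXor-a₀-count₂ true  false = refl
satXor-a₀-count₂ false true  = refl
satXor-a₀-count₂ false false = refl

expectXor-sat : {m : ℕ} (λ' : ℚ) (y : Vec Bool m) → expectXor λ' (λ c → 𝟙 (satXor c y)) ≡ ½
expectXor-sat {m} λ' y = begin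
  expectXor λ' (λ c → 𝟙 (satXor c y))
    ≡⟨ expectXor-by-a₀ λ' (λ c → 𝟙 (satXor c y)) ⟩
  ∑[ as ← allVecs m ] (½ * weight λ' as) * (𝟙 (not (true xor parity as y)) + 𝟙 (not (false xor parity as y)))
    ≡⟨ ∑-cong (λ as → trans (cong ((½ * weight λ' as) *_) (satXor-a₀-count (parity as y)))
                             (*-identityʳ (½ * weight λ' as))) (allVecs m) ⟩
  ∑[ as ← allVecs m ] ½ * weight λ' as
    ≡⟨ sym (*-distribˡ-∑ ½ (weight λ') (allVecs m)) ⟩
  ½ * (∑[ as ← allVecs m ] weight λ' as)
    ≡⟨ cong (½ *_) (∑-weight m λ') ⟩
  ½ * 1ℚ
    ≡⟨ *-identityʳ ½ ⟩
  ½
    ∎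

expectXor-sat₂ : {m : ℕ} (λ' : ℚ) (y z : Vec Bool m) →
  expectXor λ' (λ c → 𝟙 (satXor c y ∧ satXor c z)) ≡ (+ 1 / 4) * (1ℚ + bias λ' ^ hamming y z)
expectXor-sat₂ {m} λ' y z = begin
  expectXor λ' (λ c → 𝟙 (satXor c y ∧ satXor c z))
    ≡⟨ expectXor-by-a₀ λ' (λ c → 𝟙 (satXor c y ∧ satXor c z)) ⟩
  ∑[ as ← V ] (½ * weight λ' as) * (𝟙 (not (true xor parity as y) ∧ not (true xor parity as z))
                                     + 𝟙 (not (false xor parity as y) ∧ not (false xor parity as z)))
    ≡⟨ ∑-cong (λ as → cong ((½ * weight λ' as) *_) (satXor-a₀-count₂ (parity as y) (parity as z))) V ⟩
  ∑[ as ← V ] (½ * weight λ' as) * (½ * (1ℚ + χ as))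
    ≡⟨ ∑-cong (λ as → solve 2 (λ w c → (con ½ :* w) :* (con ½ :* (con 1ℚ :+ c))
                                       := con ¼ :* w :+ con ¼ :* (w :* c))
                              refl (weight λ' as) (χ as)) V ⟩
  ∑[ as ← V ] (¼ * weight λ' as + ¼ * (weight λ' as * χ as))
    ≡⟨ ∑-distrib-+ (λ as → ¼ * weight λ' as) (λ as → ¼ * (weight λ' as * χ as)) V ⟩
  (∑[ as ← V ] ¼ * weight λ' as) + (∑[ as ← V ] ¼ * (weight λ' as * χ as))
    ≡⟨ cong₂ _+_ (sym (*-distribˡ-∑ ¼ (weight λ') V))
                 (sym (*-distribˡ-∑ ¼ (λ as → weight λ' as * χ as) V)) ⟩
  ¼ * (∑[ as ← V ] weight λ' as) + ¼ * (∑[ as ← V ] weight λ' as * χ as)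
    ≡⟨ cong₂ (λ u v → ¼ * u + ¼ * v) (∑-weight m λ') (∑-weight-sign-parity λ' y z) ⟩
  ¼ * 1ℚ + ¼ * bias λ' ^ hamming y z
    ≡⟨ sym (*-distribˡ-+ ¼ 1ℚ (bias λ' ^ hamming y z)) ⟩
  ¼ * (1ℚ + bias λ' ^ hamming y z)
    ∎
  where
  V = allVecs m
  ¼ = + 1 / 4
  χ : Vec Bool m → ℚ
  χ as = sign (parity as y) * sign (parity as z)

satisfiesAll : {m s : ℕ} → Vec (XorConstraint m) s → Vec Bool m → Bool
satisfiesAll cs y = foldr _ (λ c r → satXor c y ∧ r) true cs

𝟙-satisfiesAll : {m s : ℕ} (cs : Vec (XorConstraint m) s) (y : Vec Bool m) →
                 𝟙 (satisfiesAll cs y) ≡ ∏ (λ c → 𝟙 (satXor c y)) cs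
𝟙-satisfiesAll []       y = refl
𝟙-satisfiesAll (c ∷ cs) y =
  trans (𝟙-∧ (satXor c y) (satisfiesAll cs y)) (cong (𝟙 (satXor c y) *_) (𝟙-satisfiesAll cs y))

length-filter-∧ : (p q : A → Bool) (xs : List A) →
  ℕtoℚ (length (filter (λ x → (p x ∧ q x) Bool.≟ true) xs))
    ≡ ∑[ x ← filter (λ x → p x Bool.≟ true) xs ] 𝟙 (q x)
length-filter-∧ p q []       = refl
length-filter-∧ p q (x ∷ xs) with p x
... | false = length-filter-∧ p q xs
... | true with q x
...   | true  = trans (ℕtoℚ-suc (length (filter (λ x → (p x ∧ q x) Bool.≟ true) xs)))
                      (cong (λ r → 1ℚ + r) (length-filter-∧ p q xs))
...   | false = trans (length-filter-∧ p q xs) (sym (+-identityˡ _))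

T≡∑-models : {m s : ℕ} (φ : Formula m) (cs : Vec (XorConstraint m) s) →
             T φ cs ≡ ∑[ σ ← models φ ] ∏ (λ c → 𝟙 (satXor c σ)) cs
T≡∑-models {m} φ cs =
  trans (length-filter-∧ φ (satisfiesAll cs) (allVecs m)) (∑-cong (𝟙-satisfiesAll cs) (models φ))

T²≡∑∑-models : {m s : ℕ} (φ : Formula m) (cs : Vec (XorConstraint m) s) →
  T φ cs * T φ cs ≡ ∑[ σ ← models φ ] ∑[ τ ← models φ ] ∏ (λ c → 𝟙 (satXor c σ ∧ satXor c τ)) cs
T²≡∑∑-models {m} φ cs = begin
  T φ cs * T φ cs
    ≡⟨ cong₂ _*_ (T≡∑-models φ cs) (T≡∑-models φ cs) ⟩
  (∑[ σ ← models φ ] 𝟙sat σ) * (∑[ τ ← models φ ] 𝟙sat τ)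
    ≡⟨ ∑-*-∑ 𝟙sat 𝟙sat (models φ) (models φ) ⟩
  ∑[ σ ← models φ ] ∑[ τ ← models φ ] 𝟙sat σ * 𝟙sat τ
    ≡⟨ ∑-cong (λ σ → ∑-cong (λ τ → both-sat σ τ) (models φ)) (models φ) ⟩
  ∑[ σ ← models φ ] ∑[ τ ← models φ ] ∏ (λ c → 𝟙 (satXor c σ ∧ satXor c τ)) cs
    ∎
  where
  𝟙sat : Vec Bool m → ℚ
  𝟙sat σ = ∏ (λ c → 𝟙 (satXor c σ)) cs
  both-sat : ∀ σ τ → 𝟙sat σ * 𝟙sat τ ≡ ∏ (λ c → 𝟙 (satXor c σ ∧ satXor c τ)) cs
  both-sat σ τ = trans (∏-* (λ c → 𝟙 (satXor c σ)) (λ c → 𝟙 (satXor c τ)) cs)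
                       (∏-cong (λ c → sym (𝟙-∧ (satXor c σ) (satXor c τ))) cs)

expect-cong : {m s : ℕ} (λ' : ℚ) {X Y : Vec (XorConstraint m) s → ℚ} →
              (∀ cs → X cs ≡ Y cs) → expect λ' X ≡ expect λ' Y
expect-cong {m} {s} λ' X≡Y = ∑-cong (λ cs → cong (probTuple λ' cs *_) (X≡Y cs)) (allConstraintTuples m s)

expect-∑ : {m s : ℕ} (λ' : ℚ) (xs : List A) (X : A → Vec (XorConstraint m) s → ℚ) →
           expect λ' (λ cs → ∑[ x ← xs ] X x cs) ≡ ∑[ x ← xs ] expect λ' (X x)
expect-∑ {m = m} {s} λ' xs X =
  trans (∑-cong (λ cs → *-distribˡ-∑ (probTuple λ' cs) (λ x → X x cs) xs) (allConstraintTuples m s))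
        (∑-comm (λ cs x → probTuple λ' cs * X x cs) (allConstraintTuples m s) xs)

expect-∏ : {m : ℕ} (s : ℕ) (λ' : ℚ) (g : XorConstraint m → ℚ) → expect {m} {s} λ' (∏ g) ≡ expectXor λ' g ^ s
expect-∏         zero    λ' g = refl
expect-∏ {m = m} (suc s) λ' g = begin
  expect {m} {suc s} λ' (∏ g)
    ≡⟨ ∑-concatMap (λ cs → probTuple λ' cs * ∏ g cs) (λ c → map (c ∷_) Cs) (allConstraints m) ⟩
  ∑[ c ← allConstraints m ] ∑[ cs ← map (c ∷_) Cs ] probTuple λ' cs * ∏ g cs
    ≡⟨ ∑-cong (λ c → trans (∑-map (λ cs → probTuple λ' cs * ∏ g cs) (c ∷_) Cs) (factor-out c)) (allConstraints m) ⟩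
  ∑[ c ← allConstraints m ] (probXor λ' c * g c) * expect {m} {s} λ' (∏ g)
    ≡⟨ sym (*-distribʳ-∑ (expect {m} {s} λ' (∏ g)) (λ c → probXor λ' c * g c) (allConstraints m)) ⟩
  expectXor λ' g * expect {m} {s} λ' (∏ g)
    ≡⟨ cong (expectXor λ' g *_) (expect-∏ s λ' g) ⟩
  expectXor λ' g * expectXor λ' g ^ s
    ∎
  where
  Cs = allConstraintTuples m s
  factor-out : ∀ c → ∑[ cs ← Cs ] (probXor λ' c * probTuple λ' cs) * (g c * ∏ g cs)
                   ≡ (probXor λ' c * g c) * expect {m} {s} λ' (∏ g)
  factor-out c = trans (∑-cong (λ cs → *-interchange (probXor λ' c) (probTuple λ' cs) (g c) (∏ g cs)) Cs)
                       (sym (*-distribˡ-∑ (probXor λ' c * g c) (λ cs → probTuple λ' cs * ∏ g cs) Cs))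

hamming-self : {m : ℕ} (y : Vec Bool m) → hamming y y ≡ 0
hamming-self []          = refl
hamming-self (true  ∷ y) = hamming-self y
hamming-self (false ∷ y) = hamming-self y

expect-T : {m s : ℕ} (φ : Formula m) (λ' : ℚ) → expect {m} {s} λ' (T φ) ≡ ∑[ σ ← models φ ] ½ ^ s
expect-T {m} {s} φ λ' = begin
  expect {m} {s} λ' (T φ)
    ≡⟨ expect-cong {m} {s} λ' (T≡∑-models φ) ⟩
  expect {m} {s} λ' (λ cs → ∑[ σ ← models φ ] ∏ (λ c → 𝟙 (satXor c σ)) cs)
    ≡⟨ expect-∑ {m = m} {s} λ' (models φ) (λ σ → ∏ (λ c → 𝟙 (satXor c σ))) ⟩
  ∑[ σ ← models φ ] expect {m} {s} λ' (∏ (λ c → 𝟙 (satXor c σ)))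
    ≡⟨ ∑-cong (λ σ → trans (expect-∏ s λ' _) (cong (_^ s) (expectXor-sat λ' σ))) (models φ) ⟩
  ∑[ σ ← models φ ] ½ ^ s
    ∎

expect-T²≡∑∑ : {m s : ℕ} (φ : Formula m) (λ' : ℚ) →
  expect {m} {s} λ' (λ cs → T φ cs * T φ cs)
    ≡ ∑[ σ ← models φ ] ∑[ τ ← models φ ] ((+ 1 / 4) * (1ℚ + bias λ' ^ hamming σ τ)) ^ s
expect-T²≡∑∑ {m} {s} φ λ' = begin
  expect {m} {s} λ' (λ cs → T φ cs * T φ cs)
    ≡⟨ expect-cong {m} {s} λ' (T²≡∑∑-models φ) ⟩
  expect {m} {s} λ' (λ cs → ∑[ σ ← models φ ] ∑[ τ ← models φ ] ∏ (𝟙sat₂ σ τ) cs)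
    ≡⟨ expect-∑ {m = m} {s} λ' (models φ) (λ σ cs → ∑[ τ ← models φ ] ∏ (𝟙sat₂ σ τ) cs) ⟩
  ∑[ σ ← models φ ] expect {m} {s} λ' (λ cs → ∑[ τ ← models φ ] ∏ (𝟙sat₂ σ τ) cs)
    ≡⟨ ∑-cong (λ σ → expect-∑ {m = m} {s} λ' (models φ) (λ τ → ∏ (𝟙sat₂ σ τ))) (models φ) ⟩
  ∑[ σ ← models φ ] ∑[ τ ← models φ ] expect {m} {s} λ' (∏ (𝟙sat₂ σ τ))
    ≡⟨ ∑-cong (λ σ → ∑-cong (λ τ → trans (expect-∏ s λ' (𝟙sat₂ σ τ))
                                         (cong (_^ s) (expectXor-sat₂ λ' σ τ)))
                             (models φ)) (models φ) ⟩
  ∑[ σ ← models φ ] ∑[ τ ← models φ ] ((+ 1 / 4) * (1ℚ + bias λ' ^ hamming σ τ)) ^ s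
    ∎
  where
  𝟙sat₂ : Vec Bool m → Vec Bool m → XorConstraint m → ℚ
  𝟙sat₂ σ τ c = 𝟙 (satXor c σ ∧ satXor c τ)

expect-T² : {m s : ℕ} (φ : Formula m) (λ' : ℚ) →
  expect {m} {s} λ' (λ cs → T φ cs * T φ cs)
    ≡ expect {m} {s} λ' (T φ) + (+ 1 / 4) ^ s * sumOffDiag (λ σ τ → (1ℚ + bias λ' ^ hamming σ τ) ^ s) (models φ)
expect-T² {m} {s} φ λ' = begin
  expect {m} {s} λ' (λ cs → T φ cs * T φ cs)
    ≡⟨ expect-T²≡∑∑ {m} {s} φ λ' ⟩
  ∑[ σ ← M ] ∑[ τ ← M ] (¼ * (1ℚ + bias λ' ^ hamming σ τ)) ^ s
    ≡⟨ ∑-cong (λ σ → ∑-cong (λ τ → ^-distribʳ-* ¼ (1ℚ + bias λ' ^ hamming σ τ) s) M) M ⟩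
  ∑[ σ ← M ] ∑[ τ ← M ] ¼ ^ s * H σ τ
    ≡⟨ ∑-cong (λ σ → sym (*-distribˡ-∑ (¼ ^ s) (H σ) M)) M ⟩
  ∑[ σ ← M ] ¼ ^ s * (∑[ τ ← M ] H σ τ)
    ≡⟨ sym (*-distribˡ-∑ (¼ ^ s) (λ σ → ∑[ τ ← M ] H σ τ) M) ⟩
  ¼ ^ s * (∑[ σ ← M ] ∑[ τ ← M ] H σ τ)
    ≡⟨ cong (¼ ^ s *_) (∑∑≡∑diag+sumOffDiag H M) ⟩
  ¼ ^ s * ((∑[ σ ← M ] H σ σ) + sumOffDiag H M)
    ≡⟨ *-distribˡ-+ (¼ ^ s) (∑[ σ ← M ] H σ σ) (sumOffDiag H M) ⟩
  ¼ ^ s * (∑[ σ ← M ] H σ σ) + ¼ ^ s * sumOffDiag H M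
    ≡⟨ cong (λ a → a + ¼ ^ s * sumOffDiag H M) (*-distribˡ-∑ (¼ ^ s) (λ σ → H σ σ) M) ⟩
  (∑[ σ ← M ] ¼ ^ s * H σ σ) + ¼ ^ s * sumOffDiag H M
    ≡⟨ cong (λ a → a + ¼ ^ s * sumOffDiag H M) (trans (∑-cong diagonal M) (sym (expect-T {m} {s} φ λ'))) ⟩
  expect {m} {s} λ' (T φ) + ¼ ^ s * sumOffDiag H M
    ∎
  where
  M = models φ
  ¼ = + 1 / 4
  H : Vec Bool m → Vec Bool m → ℚ
  H σ τ = (1ℚ + bias λ' ^ hamming σ τ) ^ s
  diagonal : ∀ σ → ¼ ^ s * H σ σ ≡ ½ ^ s
  diagonal σ = trans (cong (λ d → ¼ ^ s * (1ℚ + bias λ' ^ d) ^ s) (hamming-self σ))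
                     (sym (^-distribʳ-* ¼ (1ℚ + 1ℚ) s))

lemma2 : (m : ℕ) (φ : Formula m) (s : ℕ) → s ≥ 1 → (λ' : ℚ) → 0ℚ < λ' → λ' ≤ ½ →
    let N = length (models φ)
        ρ = 1ℚ - (ℕtoℚ 2 * λ')
        μ = expect {m} {s} λ' (T φ)
        S = sumOffDiag (λ σᵢ σⱼ → (1ℚ + (ρ ^ hamming σᵢ σⱼ)) ^ s) (models φ)
    in (μ ≡ ℕtoℚ N * (½ ^ s))
       × (variance {m} {s} λ' (T φ) ≡ (μ + ((+ 1 / 4) ^ s) * S) - (μ * μ))
       × (N ≢ 0 → variance {m} {s} λ' (T φ) ÷' (μ * μ)
                    ≡ (inv μ + (inv (ℕtoℚ N * ℕtoℚ N) * S)) - 1ℚ)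
-- The identities hold for all s and λ'.
lemma2 m φ s _ λ' _ _ = mean , variance-T , relativeVariance-T
  where
  n = ℕtoℚ (length (models φ))
  h = ½ ^ s
  μ = expect {m} {s} λ' (T φ)
  S = sumOffDiag (λ σ τ → (1ℚ + bias λ' ^ hamming σ τ) ^ s) (models φ)

  mean : μ ≡ n * h
  mean = trans (expect-T {m} {s} φ λ') (∑-const h (models φ))

  variance-T : variance {m} {s} λ' (T φ) ≡ (μ + (+ 1 / 4) ^ s * S) - μ * μ
  variance-T = cong (λ e → e - μ * μ) (expect-T² {m} {s} φ λ')

  relativeVariance-T : length (models φ) ≢ 0 →
                       variance {m} {s} λ' (T φ) ÷' (μ * μ) ≡ (inv μ + inv (n * n) * S) - 1ℚ
  relativeVariance-T N≢0 = begin
    variance {m} {s} λ' (T φ) ÷' (μ * μ)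
      ≡⟨ cong (_÷' (μ * μ)) (trans variance-T (cong (λ q → (μ + q * S) - μ * μ) (^-distribʳ-* ½ ½ s))) ⟩
    ((μ + (h * h) * S) - μ * μ) ÷' (μ * μ)
      ≡⟨ cong (λ x → ((x + (h * h) * S) - x * x) ÷' (x * x)) mean ⟩
    ((n * h + (h * h) * S) - (n * h) * (n * h)) ÷' ((n * h) * (n * h))
      ≡⟨ relativeVariance n h S (*-inv n (ℕtoℚ-≢0 N≢0)) h2ˢ≡1 ⟩
    (inv (n * h) + inv (n * n) * S) - 1ℚ
      ≡⟨ cong (λ x → (inv x + inv (n * n) * S) - 1ℚ) (sym mean) ⟩
    (inv μ + inv (n * n) * S) - 1ℚ
      ∎
    where
    h2ˢ≡1 : h * (1ℚ + 1ℚ) ^ s ≡ 1ℚ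
    h2ˢ≡1 = trans (sym (^-distribʳ-* ½ (1ℚ + 1ℚ) s)) (^-zeroˡ s)
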